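{- For every tense algebra $\mathfrak{A}$ and every bsi rule $\Gamma/\Delta$, we have $\mathfrak{A}\models T(\Gamma/\Delta)$ if and only if $\rho\mathfrak{A}\models\Gamma/\Delta$.
   Context: Bsi formulae: built from variables, $\bot,\top$ using $\land,\lor,\to,\leftarrow$; a bsi rule is a pair $\Gamma/\Delta$ of finite sets of bsi formulae. Tense formulae use $\land,\lor,\neg,\square_F,\lozenge_P,\bot,\top$. A tense algebra is a Boolean algebra with operators $\square_F,\lozenge_P$ such that $\square_F$ satisfies $\square_F1=1$, $\square_F(a\land b)=\square_Fa\land\square_Fb$, $\square_Fa\le a$, $\square_Fa\le\square_F\square_Fa$, $\lozenge_P$ satisfies the dual conditions ($\lozenge_P0=0$, $\lozenge_P(a\lor b)=\lozenge_Pa\lor\lozenge_Pb$, $a\le\lozenge_Pa$, $\lozenge_P\lozenge_Pa\le\lozenge_Pa$), and $\lozenge_Pa\le b$ iff $a\le\square_Fb$. For a tense algebra $\mathfrak{A}$, $\rho\mathfrak{A}$ is the bi-Heyting algebra with carrier $O(A)=\{a:\square_Fa=a\}=\{a:\lozenge_Pa=a\}$, lattice operations and $0,1$ of $\mathfrak{A}$, $a\to b:=\square_F(\neg a\lor b)$ and $a\leftarrow b:=\lozenge_P(a\land\neg b)$. The translation $T$: $T(\bot)=\bot$, $T(\top)=\top$, $T(p)=\square_Fp$, $T$ commutes with $\land,\lor$, $T(\varphi\to\psi)=\square_F(\neg T\varphi\lor T\psi)$, $T(\varphi\leftarrow\psi)=\lozenge_P(T\varphi\land\neg T\psi)$, and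 $T(\Gamma/\Delta)=T[\Gamma]/T[\Delta]$. A rule is valid on an algebra if for every valuation, whenever all premises evaluate to $1$ some conclusion does. -}

module Defs where

open import Level using (Level; _⊔_) renaming (suc to lsuc)
open import Data.Nat using (ℕ)
open import Data.Product using (Σ; _,_; proj₁; proj₂)
open import Data.List using (List)
open import Data.List.Relation.Unary.All using (All)
open import Data.List.Relation.Unary.Any using (Any)
open import Relation.Binary using (Rel)
open import Algebra.Core using (Op₁; Op₂)
open import Algebra.Lattice.Bundles using (BooleanAlgebra)
import Algebra.Lattice.Properties.BooleanAlgebra as BAProps
import Algebra.Lattice.Properties.Lattice as LatProps
import Relation.Binary.Lattice as R
import Relation.Binary.Reasoning.PartialOrder as PoR

Var : Set
Var = ℕ

data BsiFm : Set where
  var  : Var → BsiFm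
  ⊥ᵇ ⊤ᵇ : BsiFm
  _∧ᵇ_ _∨ᵇ_ _⇒ᵇ_ _⇐ᵇ_ : BsiFm → BsiFm → BsiFm

data TenseFm : Set where
  var  : Var → TenseFm
  ⊥ᵗ ⊤ᵗ : TenseFm
  _∧ᵗ_ _∨ᵗ_ : TenseFm → TenseFm → TenseFm
  ¬ᵗ_ □Fᵗ_ ◇Pᵗ_ : TenseFm → TenseFm

-- A rule Γ/Δ with finite sets of premises and conclusions (as lists).
record Rule (F : Set) : Set where
  constructor _/_
  field
    premises    : List F
    conclusions : List F

BsiRule : Set
BsiRule = Rule BsiFm

TenseRule : Set
TenseRule = Rule TenseFm

T : BsiFm → TenseFm
T (var p)   = □Fᵗ var p
T ⊥ᵇ        = ⊥ᵗ
T ⊤ᵇ        = ⊤ᵗ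
T (φ ∧ᵇ ψ)  = T φ ∧ᵗ T ψ
T (φ ∨ᵇ ψ)  = T φ ∨ᵗ T ψ
T (φ ⇒ᵇ ψ)  = □Fᵗ ((¬ᵗ T φ) ∨ᵗ T ψ)
T (φ ⇐ᵇ ψ)  = ◇Pᵗ (T φ ∧ᵗ (¬ᵗ T ψ))

Tᴿ : BsiRule → TenseRule
Tᴿ (Γ / Δ) = Data.List.map T Γ / Data.List.map T Δ

module BAOrder {c ℓ : Level} (B : BooleanAlgebra c ℓ) where
  open BooleanAlgebra B
  _≤_ : Rel Carrier ℓ
  a ≤ b = a ≈ a ∧ b

record TenseAlgebra (c ℓ : Level) : Set (lsuc (c ⊔ ℓ)) where
  field
    boolAlg : BooleanAlgebra c ℓ
  open BooleanAlgebra boolAlg public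
  open BAOrder boolAlg public
  field
    □F ◇P : Op₁ Carrier
    □F-cong : ∀ {a b} → a ≈ b → □F a ≈ □F b
    ◇P-cong : ∀ {a b} → a ≈ b → ◇P a ≈ ◇P b
    □F-⊤    : □F ⊤ ≈ ⊤
    □F-∧    : ∀ a b → □F (a ∧ b) ≈ □F a ∧ □F b
    □F-T    : ∀ a → □F a ≤ a
    □F-4    : ∀ a → □F a ≤ □F (□F a)
    ◇P-⊥    : ◇P ⊥ ≈ ⊥
    ◇P-∨    : ∀ a b → ◇P (a ∨ b) ≈ ◇P a ∨ ◇P b
    ◇P-T    : ∀ a → a ≤ ◇P a
    ◇P-4    : ∀ a → ◇P (◇P a) ≤ ◇P a
    residˡ  : ∀ {a b} → ◇P a ≤ b → a ≤ □F b
    residʳ  : ∀ {a b} → a ≤ □F b → ◇P a ≤ b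

module Validity {a ℓ : Level} {Val : Set a} {Car : Set a} {F : Set}
                (_≈_ : Rel Car ℓ) (one : Car) (⟦_⟧ : F → Val → Car) where
  valid : Rule F → Set (a ⊔ ℓ)
  valid (Γ / Δ) = ∀ (v : Val) →
    All (λ φ → ⟦ φ ⟧ v ≈ one) Γ → Any (λ ψ → ⟦ ψ ⟧ v ≈ one) Δ

module _ {c ℓ : Level} (𝔄 : TenseAlgebra c ℓ) where
  open TenseAlgebra 𝔄

  ⟦_⟧ᵗ : TenseFm → (Var → Carrier) → Carrier
  ⟦ var p ⟧ᵗ  v = v p
  ⟦ ⊥ᵗ ⟧ᵗ     v = ⊥
  ⟦ ⊤ᵗ ⟧ᵗ     v = ⊤
  ⟦ φ ∧ᵗ ψ ⟧ᵗ v = ⟦ φ ⟧ᵗ v ∧ ⟦ ψ ⟧ᵗ v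
  ⟦ φ ∨ᵗ ψ ⟧ᵗ v = ⟦ φ ⟧ᵗ v ∨ ⟦ ψ ⟧ᵗ v
  ⟦ ¬ᵗ φ ⟧ᵗ   v = ¬ ⟦ φ ⟧ᵗ v
  ⟦ □Fᵗ φ ⟧ᵗ  v = □F (⟦ φ ⟧ᵗ v)
  ⟦ ◇Pᵗ φ ⟧ᵗ  v = ◇P (⟦ φ ⟧ᵗ v)

  _⊨ᵗ_ : TenseRule → Set (c ⊔ ℓ)
  _⊨ᵗ_ = Validity.valid {Val = Var → Carrier} _≈_ ⊤ ⟦_⟧ᵗ

record BiHeytingSig (c ℓ : Level) : Set (lsuc (c ⊔ ℓ)) where
  field
    Carrier : Set c
    _≈_     : Rel Carrier ℓ
    _∧_ _∨_ _⇒_ _⇐_ : Op₂ Carrier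
    ⊥ ⊤     : Carrier

module _ {c ℓ : Level} (H : BiHeytingSig c ℓ) where
  open BiHeytingSig H

  ⟦_⟧ᵇ : BsiFm → (Var → Carrier) → Carrier
  ⟦ var p ⟧ᵇ  v = v p
  ⟦ ⊥ᵇ ⟧ᵇ     v = ⊥
  ⟦ ⊤ᵇ ⟧ᵇ     v = ⊤
  ⟦ φ ∧ᵇ ψ ⟧ᵇ v = ⟦ φ ⟧ᵇ v ∧ ⟦ ψ ⟧ᵇ v
  ⟦ φ ∨ᵇ ψ ⟧ᵇ v = ⟦ φ ⟧ᵇ v ∨ ⟦ ψ ⟧ᵇ v
  ⟦ φ ⇒ᵇ ψ ⟧ᵇ v = ⟦ φ ⟧ᵇ v ⇒ ⟦ ψ ⟧ᵇ v
  ⟦ φ ⇐ᵇ ψ ⟧ᵇ v = ⟦ φ ⟧ᵇ v ⇐ ⟦ ψ ⟧ᵇ v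

  _⊨ᵇ_ : BsiRule → Set (c ⊔ ℓ)
  _⊨ᵇ_ = Validity.valid {Val = Var → Carrier} _≈_ ⊤ ⟦_⟧ᵇ

module RhoConstruction {c ℓ : Level} (𝔄 : TenseAlgebra c ℓ) where
  open TenseAlgebra 𝔄
  open LatProps (BooleanAlgebra.lattice boolAlg) using (∨-∧-orderTheoreticLattice)
  open R.Lattice ∨-∧-orderTheoreticLattice
    using (x≤x∨y; y≤x∨y; ∨-least; ∧-greatest; x∧y≤x)
    renaming (refl to ≤-refl; trans to ≤-trans; antisym to ≤-antisym;
              reflexive to ≤-reflexive)

  Open : Carrier → Set ℓ
  Open a = □F a ≈ a

  □F-open : ∀ a → Open (□F a)
  □F-open a = ≤-antisym (□F-T (□F a)) (□F-4 a)

  ◇P-open : ∀ a → Open (◇P a)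
  ◇P-open a = ≤-antisym (□F-T (◇P a)) (residˡ (◇P-4 a))

  ⊥-open : Open ⊥
  ⊥-open = ≤-antisym (□F-T ⊥) (sym (∧-zeroˡ (□F ⊥)))
    where open BAProps boolAlg using (∧-zeroˡ)

  ∧-open : ∀ {a b} → Open a → Open b → Open (a ∧ b)
  ∧-open {a} {b} oa ob = trans (□F-∧ a b) (∧-cong oa ob)

  ∨-open : ∀ {a b} → Open a → Open b → Open (a ∨ b)
  ∨-open {a} {b} oa ob =
    ≤-antisym (□F-T (a ∨ b))
      (∨-least (residˡ (≤-trans (≤-reflexive (◇P-cong (sym oa)))
                        (≤-trans (residʳ ≤-refl) (x≤x∨y a b))))
               (residˡ (≤-trans (≤-reflexive (◇P-cong (sym ob)))
                        (≤-trans (residʳ ≤-refl) (y≤x∨y a b)))))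

  OA : Set (c ⊔ ℓ)
  OA = Σ Carrier Open

  ρ : BiHeytingSig (c ⊔ ℓ) ℓ
  ρ = record
    { Carrier = OA
    ; _≈_ = λ x y → proj₁ x ≈ proj₁ y
    ; _∧_ = λ x y → (proj₁ x ∧ proj₁ y) , ∧-open (proj₂ x) (proj₂ y)
    ; _∨_ = λ x y → (proj₁ x ∨ proj₁ y) , ∨-open (proj₂ x) (proj₂ y)
    ; _⇒_ = λ x y → □F ((¬ proj₁ x) ∨ proj₁ y) , □F-open _
    ; _⇐_ = λ x y → ◇P (proj₁ x ∧ (¬ proj₁ y)) , ◇P-open _
    ; ⊥ = ⊥ , ⊥-open
    ; ⊤ = ⊤ , □F-⊤
    }

ρ_ : ∀ {c ℓ} → TenseAlgebra c ℓ → BiHeytingSig (c ⊔ ℓ) ℓ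
ρ 𝔄 = RhoConstruction.ρ 𝔄

-- T φ evaluated under a tense valuation w is, as an element of 𝔄, exactly
-- φ evaluated in ρ𝔄 under the valuation p ↦ □F (w p): the clause T p = □F p
-- makes the variables open, and every other clause of T is the corresponding
-- operation of ρ𝔄.  Conversely every ρ𝔄-valuation arises this way, since
-- □F fixes open elements.  So both sides range over the same valuations
-- and agree on which formulae evaluate to 1.
module Submission where

open import Level using (Level)
open import Function.Base using (_∘_)
open import Function.Bundles using (_⇔_; mk⇔; Equivalence)
open import Data.Product using (_,_; proj₁; proj₂)
open import Data.List using (List; map)
open import Data.List.Relation.Unary.All as All using (All)
open import Data.List.Relation.Unary.Any as Any using (Any)
import Data.List.Relation.Unary.All.Properties as All
import Data.List.Relation.Unary.Any.Properties as Any
open import Defs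

map-All→Any-⇔ : ∀ {a b p q} {A : Set a} {B : Set b} {P : A → Set p} {Q : B → Set q}
                (f : B → A) → (∀ x → P (f x) ⇔ Q x) → (Γ Δ : List B) →
                (All P (map f Γ) → Any P (map f Δ)) ⇔ (All Q Γ → Any Q Δ)
map-All→Any-⇔ {P = P} {Q} f P∘f⇔Q Γ Δ = mk⇔
  (λ sequent → Any.map to ∘ Any.map⁻ ∘ sequent ∘ All.map⁺ ∘ All.map from)
  (λ sequent → Any.map⁺ ∘ Any.map from ∘ sequent ∘ All.map to ∘ All.map⁻)
  where
  to : ∀ {x} → P (f x) → Q x
  to {x} = Equivalence.to (P∘f⇔Q x)
  from : ∀ {x} → Q x → P (f x)
  from {x} = Equivalence.from (P∘f⇔Q x)

module _ {c ℓ : Level} (𝔄 : TenseAlgebra c ℓ) where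
  open TenseAlgebra 𝔄
  open RhoConstruction 𝔄 using (OA; □F-open)

  _Interiorises-to_ : (Var → Carrier) → (Var → OA) → Set ℓ
  w Interiorises-to v = ∀ p → □F (w p) ≈ proj₁ (v p)

  ⟦T⟧≈⟦⟧ρ : ∀ {w v} → w Interiorises-to v →
            ∀ φ → ⟦ 𝔄 ⟧ᵗ (T φ) w ≈ proj₁ (⟦ ρ 𝔄 ⟧ᵇ φ v)
  ⟦T⟧≈⟦⟧ρ w~v (var p)  = w~v p
  ⟦T⟧≈⟦⟧ρ w~v ⊥ᵇ       = refl
  ⟦T⟧≈⟦⟧ρ w~v ⊤ᵇ       = refl
  ⟦T⟧≈⟦⟧ρ w~v (φ ∧ᵇ ψ) = ∧-cong (⟦T⟧≈⟦⟧ρ w~v φ) (⟦T⟧≈⟦⟧ρ w~v ψ)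
  ⟦T⟧≈⟦⟧ρ w~v (φ ∨ᵇ ψ) = ∨-cong (⟦T⟧≈⟦⟧ρ w~v φ) (⟦T⟧≈⟦⟧ρ w~v ψ)
  ⟦T⟧≈⟦⟧ρ w~v (φ ⇒ᵇ ψ) = □F-cong (∨-cong (¬-cong (⟦T⟧≈⟦⟧ρ w~v φ)) (⟦T⟧≈⟦⟧ρ w~v ψ))
  ⟦T⟧≈⟦⟧ρ w~v (φ ⇐ᵇ ψ) = ◇P-cong (∧-cong (⟦T⟧≈⟦⟧ρ w~v φ) (¬-cong (⟦T⟧≈⟦⟧ρ w~v ψ)))

  ⟦T⟧≈⊤⇔⟦⟧ρ≈⊤ : ∀ {w v} → w Interiorises-to v →
                ∀ φ → (⟦ 𝔄 ⟧ᵗ (T φ) w ≈ ⊤) ⇔ (proj₁ (⟦ ρ 𝔄 ⟧ᵇ φ v) ≈ ⊤)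
  ⟦T⟧≈⊤⇔⟦⟧ρ≈⊤ w~v φ = mk⇔ (trans (sym (⟦T⟧≈⟦⟧ρ w~v φ))) (trans (⟦T⟧≈⟦⟧ρ w~v φ))

  T-sequent⇔ : ∀ {w v} → w Interiorises-to v → (Γ Δ : List BsiFm) →
    (All (λ φ → ⟦ 𝔄 ⟧ᵗ φ w ≈ ⊤) (map T Γ) → Any (λ φ → ⟦ 𝔄 ⟧ᵗ φ w ≈ ⊤) (map T Δ)) ⇔
    (All (λ φ → proj₁ (⟦ ρ 𝔄 ⟧ᵇ φ v) ≈ ⊤) Γ → Any (λ φ → proj₁ (⟦ ρ 𝔄 ⟧ᵇ φ v) ≈ ⊤) Δ)
  T-sequent⇔ w~v = map-All→Any-⇔ T (⟦T⟧≈⊤⇔⟦⟧ρ≈⊤ w~v)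

  interior : (Var → Carrier) → (Var → OA)
  interior w p = □F (w p) , □F-open (w p)

  interiorises-to-interior : ∀ w → w Interiorises-to interior w
  interiorises-to-interior w p = refl

  carrier-interiorises-to-self : ∀ v → (proj₁ ∘ v) Interiorises-to v
  carrier-interiorises-to-self v p = proj₂ (v p)

lemma4p38 : {c ℓ : Level} (𝔄 : TenseAlgebra c ℓ) (r : BsiRule) →
    (𝔄 ⊨ᵗ Tᴿ r) ⇔ ((ρ 𝔄) ⊨ᵇ r)
lemma4p38 𝔄 (Γ / Δ) = mk⇔
  (λ 𝔄⊨ v → Equivalence.to (T-sequent⇔ 𝔄 (carrier-interiorises-to-self 𝔄 v) Γ Δ) (𝔄⊨ (proj₁ ∘ v)))
  (λ ρ𝔄⊨ w → Equivalence.from (T-sequent⇔ 𝔄 (interiorises-to-interior 𝔄 w) Γ Δ) (ρ𝔄⊨ (interior 𝔄 w)))
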